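{- Let $r\geqslant 1$ and let $S^{(r)}=S_0\cup S_1\cup\cdots\cup S_r$ be the vertex set of the butterfly network $\mathrm{BF}(r)$ defined by \[S_i=\left\{(x,i): 2^{i+1}\ell\leqslant x\leqslant 2^{i+1}\ell+J_{i+1}-1\text{ for some integer }\ell\right\}\quad (i=0,1,\dots,r-1),\] \[S_r=\left\{(x,r): 0\leqslant x\leqslant J_{r+1}-1\right\}.\] Then \[\left|S^{(r)}\right|=J_{r+1}+\sum_{i=1}^r2^{r-i}J_i=\frac19\left[(3r+7)2^r+2(-1)^r\right].\]
   Context: $(J_n)$ is the Jacobsthal sequence: $J_0=0$, $J_1=1$, $J_n=J_{n-1}+2J_{n-2}$ for $n\geqslant 2$. The butterfly network $\mathrm{BF}(r)$ has vertex set $\bigcup_{i=0}^r V_i$ with $V_i=\{(x,i): x\in\{0,1,\dots,2^r-1\}\}$, each $x$ identified with the binary vector $(x_1,\dots,x_r)$ where $x=\sum_j x_j 2^{j-1}$; its edges join $(x,i-1)$ and $(y,i)$ whenever $1\leqslant i\leqslant r$ and $y\in\{x,x+e_i\}$ (binary addition modulo 2, $e_i$ the $i$-th unit vector). -}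

module Defs where

open import Data.Nat using (ℕ; zero; suc; _+_; _*_; _∸_; _^_; _≤_; _<_)
open import Data.Fin using (Fin; toℕ)
open import Data.Product using (Σ; ∃; _×_; _,_)
open import Data.Sum using (_⊎_)
open import Data.List using (map; applyUpTo)
open import Data.Nat.ListAction using (sum)
open import Relation.Binary.PropositionalEquality using (_≡_)

J : ℕ → ℕ
J zero = 0
J (suc zero) = 1
J (suc (suc n)) = J (suc n) + 2 * J n

Vertex : ℕ → Set
Vertex r = Fin (2 ^ r) × Fin (suc r)

InS : (r : ℕ) → Vertex r → Set
InS r (x , i) =
  (toℕ i < r × ∃ λ ℓ → (2 ^ (suc (toℕ i)) * ℓ ≤ toℕ x)
                      × (toℕ x ≤ 2 ^ (suc (toℕ i)) * ℓ + J (suc (toℕ i)) ∸ 1))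
  ⊎ (toℕ i ≡ r × toℕ x ≤ J (suc r) ∸ 1)

S : ℕ → Set
S r = Σ (Vertex r) (InS r)

sizeFormula : ℕ → ℕ
sizeFormula r = J (suc r) + sum (map (λ i → 2 ^ (r ∸ i) * J i) (applyUpTo suc r))

module Submission where

-- Below the top level, S_i meets each of the 2^(r-i-1) aligned blocks of length 2^(i+1) of
-- {0, …, 2^r - 1} in its first J_(i+1) elements (J_(i+1) ≤ 2^(i+1)), so |S_i| = 2^(r-i-1) J_(i+1);
-- the top level S_r is an initial segment of length J_(r+1) ≤ 2^r. For the closed form, 3 J_n + (-1)^n = 2^n, and the sum T_r of the lower levels
-- satisfies T_(r+1) = 2 T_r + J_(r+1), whence 9 T_r + (-1)^r = (3r+1) 2^r.

open import Defs
open import Data.Nat using (ℕ; _≤_)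
open import Data.Fin using (Fin)
open import Data.Product using (_×_; _,_)
open import Function.Bundles using (_↔_)
open import Relation.Binary.PropositionalEquality using (_≡_)

module Counting where
  open import Data.Nat using (zero; suc; _+_; _*_; _∸_; _^_; _<_; z≤n; s≤s; s≤s⁻¹; z<s; s<s)
  open import Data.Nat.Properties
  open import Data.Nat.ListAction using (sum)
  open import Data.Nat.ListAction.Properties using (sum-++)
  open import Data.List using (applyUpTo; _++_; [_])
  open import Data.List.Properties using (applyUpTo-∷ʳ; map-applyUpTo)
  open import Data.Fin as Fin using (toℕ; fromℕ<; inject≤; combine)
  open import Data.Fin.Properties
    using (toℕ-injective; toℕ<n; toℕ≤pred[n]; toℕ-fromℕ<; toℕ-inject≤; toℕ-combine; *↔×; +↔⊎)
  open import Data.Product using (Σ; ∃; uncurry; proj₁)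
  open import Data.Product.Properties using (Σ-≡,≡→≡)
  open import Data.Product.Algebra using (Σ-assoc; ×-cong)
  open import Data.Product.Function.Dependent.Propositional using (Σ-↔)
  open import Data.Sum using (_⊎_; inj₁; inj₂)
  open import Data.Sum.Algebra using (⊎-cong; ⊎-comm)
  open import Data.Empty using (⊥-elim)
  open import Function.Bundles using (_⇔_; mk⇔; mk↔ₛ′; Equivalence)
  open import Function.Properties.Inverse using (↔-refl; ↔-sym; ↔-trans)
  open import Relation.Nullary.Negation using (¬_)
  open import Relation.Nullary.Irrelevant using (Irrelevant)
  open import Relation.Binary.PropositionalEquality
    using (refl; sym; trans; cong; cong₂; subst; module ≡-Reasoning)

  irrelevant-⇔⇒↔ : {A B : Set} → Irrelevant A → Irrelevant B → A ⇔ B → A ↔ B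
  irrelevant-⇔⇒↔ irrA irrB A⇔B =
    mk↔ₛ′ to from (λ b → irrB (to (from b)) b) (λ a → irrA (from (to a)) a)
    where open Equivalence A⇔B

  ⊎-selectˡ : {P Q A B : Set} → Irrelevant P → P → ¬ Q → ((P × A) ⊎ (Q × B)) ↔ A
  ⊎-selectˡ {P} {Q} {A} {B} irrP p ¬q = mk↔ₛ′ to (λ a → inj₁ (p , a)) (λ _ → refl) from∘to
    where
    to : (P × A) ⊎ (Q × B) → A
    to (inj₁ (_ , a)) = a
    to (inj₂ (q , _)) = ⊥-elim (¬q q)
    from∘to : ∀ s → inj₁ (p , to s) ≡ s
    from∘to (inj₁ (p′ , a)) = cong (λ p″ → inj₁ (p″ , a)) (irrP p p′)
    from∘to (inj₂ (q , _)) = ⊥-elim (¬q q)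

  Σ<↔Fin : ∀ {n j} → j ≤ n → Σ (Fin n) (λ x → toℕ x < j) ↔ Fin j
  Σ<↔Fin {n} {j} j≤n = mk↔ₛ′ (λ (x , x<j) → fromℕ< x<j) from
    (λ y → toℕ-injective (trans (toℕ-fromℕ< _) (toℕ-inject≤ y j≤n)))
    (λ (x , x<j) → Σ-≡,≡→≡ (toℕ-injective (trans (toℕ-inject≤ _ j≤n) (toℕ-fromℕ< x<j)) , <-irrelevant _ _))
    where
    from : Fin j → Σ (Fin n) (λ x → toℕ x < j)
    from y = inject≤ y j≤n , subst (_< j) (sym (toℕ-inject≤ y j≤n)) (toℕ<n y)

  Σ-Fin↔sum : ∀ n (f : ℕ → ℕ) {P : Fin n → Set} → (∀ k → P k ↔ Fin (f (toℕ k))) →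
              Σ (Fin n) P ↔ Fin (sum (applyUpTo f n))
  Σ-Fin↔sum zero f P↔ = mk↔ₛ′ (λ ()) (λ ()) (λ ()) (λ ())
  Σ-Fin↔sum (suc n) f {P} P↔ =
    ↔-trans split
      (↔-trans (⊎-cong (P↔ Fin.zero) (Σ-Fin↔sum n (λ i → f (suc i)) (λ k → P↔ (Fin.suc k))))
               (↔-sym +↔⊎))
    where
    split : Σ (Fin (suc n)) P ↔ (P Fin.zero ⊎ Σ (Fin n) (λ k → P (Fin.suc k)))
    split = mk↔ₛ′ (λ { (Fin.zero , p) → inj₁ p ; (Fin.suc k , p) → inj₂ (k , p) })
                  (λ { (inj₁ p) → Fin.zero , p ; (inj₂ (k , p)) → Fin.suc k , p })
                  (λ { (inj₁ p) → refl ; (inj₂ (k , p)) → refl })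
                  (λ { (Fin.zero , p) → refl ; (Fin.suc k , p) → refl })

  ≤∸1⇔< : ∀ {m n} → 1 ≤ n → (m ≤ n ∸ 1) ⇔ (m < n)
  ≤∸1⇔< {n = suc n} _ = mk⇔ s≤s s≤s⁻¹

  +-≤-*-suc : ∀ q ℓ {n} → n ≤ q → q * ℓ + n ≤ q * suc ℓ
  +-≤-*-suc q ℓ {n} n≤q = begin
    q * ℓ + n  ≤⟨ +-monoʳ-≤ (q * ℓ) n≤q ⟩
    q * ℓ + q  ≡⟨ +-comm (q * ℓ) q ⟩
    q + q * ℓ  ≡⟨ *-suc q ℓ ⟨
    q * suc ℓ  ∎
    where open ≤-Reasoning

  block-index-≤ : ∀ q {ℓ ℓ′ x} → q * ℓ ≤ x → x < q * suc ℓ′ → ℓ ≤ ℓ′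
  block-index-≤ q qℓ≤x x<q[1+ℓ′] = s≤s⁻¹ (*-cancelˡ-< q _ _ (≤-<-trans qℓ≤x x<q[1+ℓ′]))

  block-index-unique : ∀ q {ℓ ℓ′ x} → q * ℓ ≤ x → x < q * suc ℓ →
                       q * ℓ′ ≤ x → x < q * suc ℓ′ → ℓ ≡ ℓ′
  block-index-unique q qℓ≤x x<q[1+ℓ] qℓ′≤x x<q[1+ℓ′] =
    ≤-antisym (block-index-≤ q qℓ≤x x<q[1+ℓ′]) (block-index-≤ q qℓ′≤x x<q[1+ℓ])

  InBlocks : ℕ → ℕ → ℕ → Set
  InBlocks q j x = ∃ λ ℓ → q * ℓ ≤ x × x ≤ q * ℓ + j ∸ 1

  module _ {q j : ℕ} (1≤j : 1 ≤ j) (j≤q : j ≤ q) where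

    InBlocks-upper⇔ : ∀ ℓ {x} → (x ≤ q * ℓ + j ∸ 1) ⇔ (x < q * ℓ + j)
    InBlocks-upper⇔ ℓ = ≤∸1⇔< (≤-trans 1≤j (m≤n+m j (q * ℓ)))

    InBlocks-<-*-suc : ∀ {ℓ x} → x ≤ q * ℓ + j ∸ 1 → x < q * suc ℓ
    InBlocks-<-*-suc {ℓ} x≤ = <-≤-trans (Equivalence.to (InBlocks-upper⇔ ℓ) x≤) (+-≤-*-suc q ℓ j≤q)

    InBlocks-irrelevant : ∀ {x} → Irrelevant (InBlocks q j x)
    InBlocks-irrelevant (ℓ , qℓ≤x , x≤) (ℓ′ , qℓ′≤x , x≤′)
      with block-index-unique q qℓ≤x (InBlocks-<-*-suc x≤) qℓ′≤x (InBlocks-<-*-suc x≤′)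
    ... | refl = cong₂ (λ u v → ℓ , u , v) (≤-irrelevant qℓ≤x qℓ′≤x) (≤-irrelevant x≤ x≤′)

    <⇔InBlocks : ∀ {a b} → b < q → (b < j) ⇔ InBlocks q j (q * a + b)
    <⇔InBlocks {a} {b} b<q = mk⇔ from to
      where
      from : b < j → InBlocks q j (q * a + b)
      from b<j = a , m≤m+n (q * a) b , Equivalence.from (InBlocks-upper⇔ a) (+-monoʳ-< (q * a) b<j)
      to : InBlocks q j (q * a + b) → b < j
      to (ℓ , qℓ≤x , x≤) with block-index-unique q qℓ≤x (InBlocks-<-*-suc x≤) (m≤m+n (q * a) b)
                                 (<-≤-trans (+-monoʳ-< (q * a) b<q) (+-≤-*-suc q a ≤-refl))
      ... | refl = +-cancelˡ-< (q * a) b j (Equivalence.to (InBlocks-upper⇔ a) x≤)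

    InBlocks↔ : ∀ p → Σ (Fin (p * q)) (λ x → InBlocks q j (toℕ x)) ↔ Fin (p * j)
    InBlocks↔ p =
      ↔-trans (↔-sym (Σ-↔ (↔-sym (*↔× {p} {q})) coordinates))
        (↔-trans Σ-assoc (↔-trans (×-cong ↔-refl (Σ<↔Fin j≤q)) (↔-sym (*↔× {p} {j}))))
      where
      coordinates : ∀ {ab} → uncurry (λ _ b → toℕ b < j) ab ↔ InBlocks q j (toℕ (uncurry (combine {p}) ab))
      coordinates {a , b} = irrelevant-⇔⇒↔ <-irrelevant InBlocks-irrelevant
        (subst (λ x → (toℕ b < j) ⇔ InBlocks q j x) (sym (toℕ-combine a b)) (<⇔InBlocks (toℕ<n b)))

  J-suc-pos : ∀ n → 1 ≤ J (suc n)
  J-suc-pos zero = s≤s z≤n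
  J-suc-pos (suc n) = ≤-trans (J-suc-pos n) (m≤m+n _ _)

  J-suc≤2^ : ∀ n → J (suc n) ≤ 2 ^ n
  J-suc≤2^ n = proj₁ (bounds n)
    where
    bounds : ∀ n → J (suc n) ≤ 2 ^ n × 2 * J n ≤ 2 ^ n
    bounds zero = s≤s z≤n , z≤n
    bounds (suc n) with bounds n
    ... | J[1+n]≤ , 2J[n]≤ =
      ≤-trans (+-mono-≤ J[1+n]≤ 2J[n]≤) (≤-reflexive (cong (2 ^ n +_) (sym (+-identityʳ (2 ^ n))))) ,
      *-monoʳ-≤ 2 J[1+n]≤

  Level : (r : ℕ) → Fin (suc r) → Set
  Level r i = Σ (Fin (2 ^ r)) (λ x → InS r (x , i))

  S↔ΣLevel : ∀ r → S r ↔ Σ (Fin (suc r)) (Level r)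
  S↔ΣLevel r = mk↔ₛ′ (λ ((x , i) , x∈S) → i , x , x∈S) (λ (i , x , x∈S) → (x , i) , x∈S)
    (λ _ → refl) (λ _ → refl)

  -- At the top level i = r the truncated exponent r ∸ (r + 1) is 0, so the size is J_(r+1) there too.
  levelSize : ℕ → ℕ → ℕ
  levelSize r i = 2 ^ (r ∸ suc i) * J (suc i)

  levelSize-top : ∀ r → levelSize r r ≡ J (suc r)
  levelSize-top r = begin
    2 ^ (r ∸ suc r) * J (suc r)  ≡⟨ cong (λ e → 2 ^ e * J (suc r)) (m≤n⇒m∸n≡0 (n≤1+n r)) ⟩
    1 * J (suc r)                ≡⟨ *-identityˡ (J (suc r)) ⟩
    J (suc r)                    ∎
    where open ≡-Reasoning

  lowerLevel↔ : ∀ r (i : Fin (suc r)) → toℕ i < r → Level r i ↔ Fin (levelSize r (toℕ i))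
  lowerLevel↔ r i i<r =
    ↔-trans (Σ-↔ ↔-refl (⊎-selectˡ <-irrelevant i<r (λ i≡r → <-irrefl i≡r i<r)))
      (subst (λ n → Σ (Fin n) (λ x → InBlocks q j (toℕ x)) ↔ Fin (levelSize r (toℕ i)))
             (sym 2^r≡p*q) (InBlocks↔ (J-suc-pos (toℕ i)) j≤q (2 ^ (r ∸ suc (toℕ i)))))
    where
    q = 2 ^ suc (toℕ i)
    j = J (suc (toℕ i))
    j≤q : j ≤ q
    j≤q = ≤-trans (J-suc≤2^ (toℕ i)) (^-monoʳ-≤ 2 (n≤1+n (toℕ i)))
    2^r≡p*q : 2 ^ r ≡ 2 ^ (r ∸ suc (toℕ i)) * q
    2^r≡p*q = trans (cong (2 ^_) (sym (m∸n+n≡m i<r))) (^-distribˡ-+-* 2 (r ∸ suc (toℕ i)) (suc (toℕ i)))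

  topLevel↔ : ∀ r (i : Fin (suc r)) → toℕ i ≡ r → Level r i ↔ Fin (levelSize r (toℕ i))
  topLevel↔ r i i≡r =
    ↔-trans (Σ-↔ ↔-refl (↔-trans (⊎-comm _ _) (⊎-selectˡ ≡-irrelevant i≡r (λ i<r → <-irrefl i≡r i<r))))
      (↔-trans (Σ-↔ ↔-refl (irrelevant-⇔⇒↔ ≤-irrelevant <-irrelevant (≤∸1⇔< (J-suc-pos r))))
        (subst (λ n → Σ (Fin (2 ^ r)) (λ x → toℕ x < J (suc r)) ↔ Fin n)
               (sym (trans (cong (levelSize r) i≡r) (levelSize-top r))) (Σ<↔Fin (J-suc≤2^ r))))

  Level↔ : ∀ r (i : Fin (suc r)) → Level r i ↔ Fin (levelSize r (toℕ i))
  Level↔ r i with m≤n⇒m<n∨m≡n (toℕ≤pred[n] i)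
  ... | inj₁ i<r = lowerLevel↔ r i i<r
  ... | inj₂ i≡r = topLevel↔ r i i≡r

  S↔Fin : ∀ r → S r ↔ Fin (sum (applyUpTo (levelSize r) (suc r)))
  S↔Fin r = ↔-trans (S↔ΣLevel r) (Σ-Fin↔sum (suc r) (levelSize r) (Level↔ r))

  sum-applyUpTo-suc : ∀ (f : ℕ → ℕ) n → sum (applyUpTo f (suc n)) ≡ sum (applyUpTo f n) + f n
  sum-applyUpTo-suc f n = begin
    sum (applyUpTo f (suc n))         ≡⟨ cong sum (applyUpTo-∷ʳ f n) ⟨
    sum (applyUpTo f n ++ [ f n ])    ≡⟨ sum-++ (applyUpTo f n) [ f n ] ⟩
    sum (applyUpTo f n) + (f n + 0)   ≡⟨ cong (sum (applyUpTo f n) +_) (+-identityʳ (f n)) ⟩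
    sum (applyUpTo f n) + f n         ∎
    where open ≡-Reasoning

  sum-applyUpTo-scale : ∀ m {f g : ℕ → ℕ} n → (∀ {i} → i < n → f i ≡ m * g i) →
                        sum (applyUpTo f n) ≡ m * sum (applyUpTo g n)
  sum-applyUpTo-scale m zero _ = sym (*-zeroʳ m)
  sum-applyUpTo-scale m {f} {g} (suc n) f≡m*g =
    trans (cong₂ _+_ (f≡m*g z<s) (sum-applyUpTo-scale m n (λ i<n → f≡m*g (s<s i<n))))
          (sym (*-distribˡ-+ m (g 0) _))

  lowerSum : ℕ → ℕ
  lowerSum r = sum (applyUpTo (levelSize r) r)

  sizeFormula≡ : ∀ r → sizeFormula r ≡ J (suc r) + lowerSum r
  sizeFormula≡ r = cong (λ l → J (suc r) + sum l) (map-applyUpTo suc (λ i → 2 ^ (r ∸ i) * J i) r)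

  sum-levelSize : ∀ r → sum (applyUpTo (levelSize r) (suc r)) ≡ sizeFormula r
  sum-levelSize r = begin
    sum (applyUpTo (levelSize r) (suc r))  ≡⟨ sum-applyUpTo-suc (levelSize r) r ⟩
    lowerSum r + levelSize r r             ≡⟨ cong (lowerSum r +_) (levelSize-top r) ⟩
    lowerSum r + J (suc r)                 ≡⟨ +-comm (lowerSum r) (J (suc r)) ⟩
    J (suc r) + lowerSum r                 ≡⟨ sizeFormula≡ r ⟨
    sizeFormula r                          ∎
    where open ≡-Reasoning

  levelSize-suc : ∀ {r i} → i < r → levelSize (suc r) i ≡ 2 * levelSize r i
  levelSize-suc {r} {i} i<r = begin
    2 ^ (r ∸ i) * J (suc i)            ≡⟨ cong (λ e → 2 ^ e * J (suc i)) (+-∸-assoc 1 i<r) ⟩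
    2 * 2 ^ (r ∸ suc i) * J (suc i)    ≡⟨ *-assoc 2 (2 ^ (r ∸ suc i)) (J (suc i)) ⟩
    2 * (2 ^ (r ∸ suc i) * J (suc i))  ∎
    where open ≡-Reasoning

  lowerSum-suc : ∀ r → lowerSum (suc r) ≡ 2 * lowerSum r + J (suc r)
  lowerSum-suc r = begin
    lowerSum (suc r)                   ≡⟨ sum-applyUpTo-suc (levelSize (suc r)) r ⟩
    sum (applyUpTo (levelSize (suc r)) r) + levelSize (suc r) r
      ≡⟨ cong₂ _+_ (sum-applyUpTo-scale 2 r levelSize-suc) (cong (λ e → 2 ^ e * J (suc r)) (n∸n≡0 r)) ⟩
    2 * lowerSum r + (J (suc r) + 0)   ≡⟨ cong (2 * lowerSum r +_) (+-identityʳ (J (suc r))) ⟩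
    2 * lowerSum r + J (suc r)         ∎
    where open ≡-Reasoning

open import Data.Integer using (ℤ; +_; -_; _+_; _*_; _^_; -1ℤ)
open import Data.Integer.Properties using (pos-+; pos-*)
open import Data.Integer.Tactic.RingSolver using (solve-∀)
open import Data.Nat as ℕ using (suc; zero)
open import Relation.Binary.PropositionalEquality using (refl; cong; cong₂; trans; subst; module ≡-Reasoning)
open Counting using (S↔Fin; sum-levelSize; lowerSum; lowerSum-suc; sizeFormula≡)

J-closed : ∀ n → + 3 * + J n + -1ℤ ^ n ≡ (+ 2) ^ n
J-closed zero = refl
J-closed (suc zero) = refl
J-closed (suc (suc n)) = begin
  + 3 * + J (suc (suc n)) + -1ℤ ^ suc (suc n)
    ≡⟨ cong (λ z → + 3 * z + -1ℤ ^ suc (suc n))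
            (trans (pos-+ (J (suc n)) _) (cong (λ z → + J (suc n) + z) (pos-* 2 (J n)))) ⟩
  + 3 * (+ J (suc n) + + 2 * + J n) + -1ℤ * (-1ℤ * -1ℤ ^ n)
    ≡⟨ regroup (+ J (suc n)) (+ J n) (-1ℤ ^ n) ⟩
  (+ 3 * + J (suc n) + -1ℤ * -1ℤ ^ n) + + 2 * (+ 3 * + J n + -1ℤ ^ n)
    ≡⟨ cong₂ (λ a b → a + + 2 * b) (J-closed (suc n)) (J-closed n) ⟩
  + 2 * (+ 2) ^ n + + 2 * (+ 2) ^ n
    ≡⟨ double ((+ 2) ^ n) ⟩
  (+ 2) ^ suc (suc n) ∎
  where
  open ≡-Reasoning
  regroup : ∀ a b u → + 3 * (a + + 2 * b) + -1ℤ * (-1ℤ * u) ≡ (+ 3 * a + -1ℤ * u) + + 2 * (+ 3 * b + u)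
  regroup = solve-∀
  double : ∀ t → + 2 * t + + 2 * t ≡ + 2 * (+ 2 * t)
  double = solve-∀

lowerSum-closed : ∀ r → + 9 * + lowerSum r + -1ℤ ^ r ≡ (+ 3 * + r + + 1) * (+ 2) ^ r
lowerSum-closed zero = refl
lowerSum-closed (suc r) = begin
  + 9 * + lowerSum (suc r) + -1ℤ * -1ℤ ^ r
    ≡⟨ cong (λ z → + 9 * z + -1ℤ * -1ℤ ^ r)
            (trans (cong +_ (lowerSum-suc r))
                   (trans (pos-+ (2 ℕ.* lowerSum r) _) (cong (_+ + J (suc r)) (pos-* 2 (lowerSum r))))) ⟩
  + 9 * (+ 2 * + lowerSum r + + J (suc r)) + -1ℤ * -1ℤ ^ r
    ≡⟨ regroup (+ lowerSum r) (+ J (suc r)) (-1ℤ ^ r) ⟩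
  + 2 * (+ 9 * + lowerSum r + -1ℤ ^ r) + + 3 * (+ 3 * + J (suc r) + -1ℤ * -1ℤ ^ r)
    ≡⟨ cong₂ (λ a b → + 2 * a + + 3 * b) (lowerSum-closed r) (J-closed (suc r)) ⟩
  + 2 * ((+ 3 * + r + + 1) * (+ 2) ^ r) + + 3 * (+ 2 * (+ 2) ^ r)
    ≡⟨ collect (+ r) ((+ 2) ^ r) ⟩
  (+ 3 * + suc r + + 1) * (+ 2 * (+ 2) ^ r) ∎
  where
  open ≡-Reasoning
  regroup : ∀ T j u → + 9 * (+ 2 * T + j) + -1ℤ * u ≡ + 2 * (+ 9 * T + u) + + 3 * (+ 3 * j + -1ℤ * u)
  regroup = solve-∀
  collect : ∀ R t → + 2 * ((+ 3 * R + + 1) * t) + + 3 * (+ 2 * t) ≡ (+ 3 * (+ 1 + R) + + 1) * (+ 2 * t)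
  collect = solve-∀

sizeFormula-closed : ∀ r → + 9 * + sizeFormula r ≡ (+ 3 * + r + + 7) * (+ 2) ^ r + + 2 * -1ℤ ^ r
sizeFormula-closed r = begin
  + 9 * + sizeFormula r
    ≡⟨ cong (λ n → + 9 * n) (trans (cong +_ (sizeFormula≡ r)) (pos-+ (J (suc r)) (lowerSum r))) ⟩
  + 9 * (+ J (suc r) + + lowerSum r)
    ≡⟨ regroup (+ J (suc r)) (+ lowerSum r) (-1ℤ ^ r) ⟩
  + 3 * (+ 3 * + J (suc r) + -1ℤ * -1ℤ ^ r) + (+ 9 * + lowerSum r + -1ℤ ^ r) + + 2 * -1ℤ ^ r
    ≡⟨ cong₂ (λ a b → + 3 * a + b + + 2 * -1ℤ ^ r) (J-closed (suc r)) (lowerSum-closed r) ⟩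
  + 3 * (+ 2 * (+ 2) ^ r) + (+ 3 * + r + + 1) * (+ 2) ^ r + + 2 * -1ℤ ^ r
    ≡⟨ collect (+ r) ((+ 2) ^ r) (-1ℤ ^ r) ⟩
  (+ 3 * + r + + 7) * (+ 2) ^ r + + 2 * -1ℤ ^ r ∎
  where
  open ≡-Reasoning
  regroup : ∀ j T u → + 9 * (j + T) ≡ + 3 * (+ 3 * j + -1ℤ * u) + (+ 9 * T + u) + + 2 * u
  regroup = solve-∀
  collect : ∀ R t u → + 3 * (+ 2 * t) + (+ 3 * R + + 1) * t + + 2 * u ≡ (+ 3 * R + + 7) * t + + 2 * u
  collect = solve-∀

lemma3p1 : (r : ℕ) → 1 ≤ r →
    (S r ↔ Fin (sizeFormula r))
    × (+ 9 * + sizeFormula r ≡ (+ 3 * + r + + 7) * (+ 2) ^ r + + 2 * (- + 1) ^ r)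
lemma3p1 r _ = subst (λ n → S r ↔ Fin n) (sum-levelSize r) (S↔Fin r) , sizeFormula-closed r
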